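{- The formal power series $$F_2(x)=\prod_{s=0}^{\infty}\big((x^2)^{4^s}+x^{4^s}+1\big)\big((x^6)^{4^s}-1\big)\big((x^4)^{4^s}-1\big)$$ and $$F_3(x)=\prod_{s=0}^{\infty}\big((x^2)^{4^s}+x^{4^s}+1\big)\big((x^6)^{4^s}+1\big)\big(1-(x^4)^{4^s}\big)$$ are $4$-automatic.
   Context: A power series $\sum_n c_nx^n$ is $4$-automatic if the set of sequences $\{(c_{4^l n+b})_{n\in\mathbf{N}} : l\in\mathbf{N},\ 0\le b<4^l\}$ is finite. -}

module Defs where

open import Data.Nat using (ℕ; zero; suc; _≤_; _<_; _^_; _∸_) renaming (_*_ to _*ℕ_; _+_ to _+ℕ_)
open import Data.Nat.Properties using (_≟_)
open import Data.Integer using (ℤ; 0ℤ; 1ℤ; _+_; _*_; -_)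
open import Data.List using (List)
open import Data.List.Relation.Unary.Any using (Any)
open import Data.Product using (Σ; _×_)
open import Relation.Nullary using (yes; no)
open import Relation.Binary.PropositionalEquality using (_≡_)

PowerSeries : Set
PowerSeries = ℕ → ℤ

sumUpTo : ℕ → (ℕ → ℤ) → ℤ
sumUpTo zero    f = f zero
sumUpTo (suc n) f = sumUpTo n f + f (suc n)

one : PowerSeries
one zero    = 1ℤ
one (suc _) = 0ℤ

monomial : ℕ → PowerSeries
monomial k n with n ≟ k
... | yes _ = 1ℤ
... | no  _ = 0ℤ

_⊕_ : PowerSeries → PowerSeries → PowerSeries
(f ⊕ g) n = f n + g n

⊖_ : PowerSeries → PowerSeries
(⊖ f) n = - f n

_⊝_ : PowerSeries → PowerSeries → PowerSeries
f ⊝ g = f ⊕ (⊖ g)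

_⊛_ : PowerSeries → PowerSeries → PowerSeries
(f ⊛ g) n = sumUpTo n (λ i → f i * g (n ∸ i))

prodBelow : (ℕ → PowerSeries) → ℕ → PowerSeries
prodBelow P zero    = one
prodBelow P (suc M) = prodBelow P M ⊛ P M

IsInfiniteProduct : (ℕ → PowerSeries) → PowerSeries → Set
IsInfiniteProduct P F =
  (n : ℕ) → Σ ℕ λ N → (M : ℕ) → N ≤ M → prodBelow P M n ≡ F n

-- k-automatic: the k-kernel { (c_{k^l n + b})_n : l ∈ ℕ, 0 ≤ b < k^l }
-- is a finite set of sequences, i.e. every kernel sequence equals one of
-- finitely many sequences listed in L.
IsAutomatic : ℕ → PowerSeries → Set
IsAutomatic k c =
  Σ (List PowerSeries) λ L →
    (l b : ℕ) → b < k ^ l →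
      Any (λ g → (n : ℕ) → g n ≡ c ((k ^ l) *ℕ n +ℕ b)) L

factor₂ : ℕ → PowerSeries
factor₂ s =
  ((monomial (2 *ℕ 4 ^ s) ⊕ monomial (4 ^ s)) ⊕ one)
  ⊛ ((monomial (6 *ℕ 4 ^ s) ⊝ one) ⊛ (monomial (4 *ℕ 4 ^ s) ⊝ one))

factor₃ : ℕ → PowerSeries
factor₃ s =
  ((monomial (2 *ℕ 4 ^ s) ⊕ monomial (4 ^ s)) ⊕ one)
  ⊛ ((monomial (6 *ℕ 4 ^ s) ⊕ one) ⊛ (one ⊝ monomial (4 *ℕ 4 ^ s)))

{-# OPTIONS --safe #-}
-- The partial products Q_M = ∏_{s<M} P(x^{4^s}) satisfy Q_{M+1} = Q_M · P(x^{4^M}), and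
-- deg Q_M < 4·4^M because deg P ≤ 12.  Hence for r < 4^M the coefficients of Q_M at
-- r, r + 4^M, r + 2·4^M, r + 3·4^M form a state in ℤ⁴, and the state of t·4^M + r arises
-- from that of r by a linear map depending only on the digit t: multiply by P(y) and keep
-- every fourth coefficient, starting at the t-th.  Reading the base-4 digits of n, least
-- significant first, from the state (1,0,0,0) thus yields c_n as the first entry; as
-- P(0) = 1, leading zero digits do not change it, so the Q_M converge coefficientwise.
-- The sequence (c_{4^l n + b})_n is the same computation started from the state reached
-- after reading b, so the 4-kernel is indexed by the states reachable from (1,0,0,0).
-- For both products these form a finite set, found by search and checked to be closed.
module Submission where

open import Defs
open import Data.Nat
  using (ℕ; zero; suc; _∸_; _^_; _≤_; _<_; z≤n; s≤s; _≤?_; _/_; _%_; NonZero)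
  renaming (_*_ to _*ℕ_; _+_ to _+ℕ_)
open import Data.Nat.DivMod
  using (m≡m%n+[m/n]*n; m%n<n; m<n*o⇒m/o<n; m<n⇒m%n≡m; m*n/n≡m; +-distrib-/-∣ʳ; [m+kn]%n≡m%n)
open import Data.Nat.Divisibility using (divides)
import Data.Nat.Tactic.RingSolver as ℕ-Solver
open import Data.Integer.Tactic.RingSolver using (solve-∀)
import Data.Nat.Properties as ℕ
open import Data.Integer using (ℤ; 0ℤ; 1ℤ; -1ℤ; _+_; _*_; -_)
import Data.Integer.Properties as ℤ
open import Data.Product using (Σ; _×_; _,_; proj₁; proj₂)
open import Data.Product.Properties using (≡-dec)
open import Data.List using (List; []; _∷_; _++_; map; concatMap; upTo; deduplicate)
open import Data.List.Relation.Unary.All as All using (All; []; _∷_; all?)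
open import Data.List.Relation.Unary.Any as Any using (here)
open import Data.List.Membership.Propositional using (_∈_)
open import Data.List.Membership.Propositional.Properties using (∈-map⁺; ∈-upTo⁺)
open import Function using (_∘_)
open import Relation.Binary.Definitions using (DecidableEquality)
open import Relation.Binary.PropositionalEquality
open import Relation.Nullary using (Dec; yes; no; ¬_; contradiction)
open import Relation.Nullary.Decidable using (from-yes)

sumUpTo-cong : ∀ n {f g : ℕ → ℤ} → (∀ i → i ≤ n → f i ≡ g i) → sumUpTo n f ≡ sumUpTo n g
sumUpTo-cong zero    eq = eq 0 z≤n
sumUpTo-cong (suc n) eq =
  cong₂ _+_ (sumUpTo-cong n (λ i i≤n → eq i (ℕ.m≤n⇒m≤1+n i≤n))) (eq (suc n) ℕ.≤-refl)

sumUpTo-zero : ∀ n {f : ℕ → ℤ} → (∀ i → i ≤ n → f i ≡ 0ℤ) → sumUpTo n f ≡ 0ℤ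
sumUpTo-zero zero    z = z 0 z≤n
sumUpTo-zero (suc n) z =
  cong₂ _+_ (sumUpTo-zero n (λ i i≤n → z i (ℕ.m≤n⇒m≤1+n i≤n))) (z (suc n) ℕ.≤-refl)

sumUpTo-single : ∀ n {f : ℕ → ℤ} j → j ≤ n → (∀ i → i ≤ n → i ≢ j → f i ≡ 0ℤ) →
                 sumUpTo n f ≡ f j
sumUpTo-single zero    zero z≤n _ = refl
sumUpTo-single (suc n) {f} j j≤1+n z with j ℕ.≟ suc n
... | yes refl =
  trans (cong (_+ f (suc n)) (sumUpTo-zero n (λ i i≤n →
           z i (ℕ.m≤n⇒m≤1+n i≤n) (λ i≡1+n → ℕ.<-irrefl i≡1+n (s≤s i≤n)))))
        (ℤ.+-identityˡ _)
... | no j≢1+n =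
  trans (cong₂ _+_ (sumUpTo-single n j (ℕ.≤-pred (ℕ.≤∧≢⇒< j≤1+n j≢1+n))
                                   (λ i i≤n → z i (ℕ.m≤n⇒m≤1+n i≤n)))
                   (z (suc n) ℕ.≤-refl (j≢1+n ∘ sym)))
        (ℤ.+-identityʳ _)

sumUpTo-linear : ∀ n (c : ℤ) (u v : ℕ → ℤ) →
                 sumUpTo n (λ i → c * u i + v i) ≡ c * sumUpTo n u + sumUpTo n v
sumUpTo-linear zero    c u v = refl
sumUpTo-linear (suc n) c u v =
  trans (cong (_+ (c * u (suc n) + v (suc n))) (sumUpTo-linear n c u v))
        (regroup c (sumUpTo n u) (sumUpTo n v) (u (suc n)) (v (suc n)))
  where
  regroup : ∀ c a b x y → (c * a + b) + (c * x + y) ≡ c * (a + x) + (b + y)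
  regroup = solve-∀

monomial-diag : ∀ a → monomial a a ≡ 1ℤ
monomial-diag a with a ℕ.≟ a
... | yes _   = refl
... | no  a≢a = contradiction refl a≢a

monomial-off : ∀ {a n} → n ≢ a → monomial a n ≡ 0ℤ
monomial-off {a} {n} n≢a with n ℕ.≟ a
... | yes n≡a = contradiction n≡a n≢a
... | no  _   = refl

monomial-∸ : ∀ b {a n} → a ≤ n → monomial b (n ∸ a) ≡ monomial (b +ℕ a) n
monomial-∸ b {a} {n} a≤n with n ∸ a ℕ.≟ b
... | yes n∸a≡b = sym (trans (cong (monomial (b +ℕ a)) n≡b+a) (monomial-diag _))
  where
  n≡b+a : n ≡ b +ℕ a
  n≡b+a = trans (sym (ℕ.m∸n+n≡m a≤n)) (cong (_+ℕ a) n∸a≡b)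
... | no n∸a≢b =
  sym (monomial-off λ n≡b+a → n∸a≢b (trans (cong (_∸ a) n≡b+a) (ℕ.m+n∸n≡m b a)))

one≗monomial-0 : one ≗ monomial 0
one≗monomial-0 zero    = refl
one≗monomial-0 (suc n) = refl

shift : ℕ → PowerSeries → PowerSeries
shift a f n with a ≤? n
... | yes _ = f (n ∸ a)
... | no  _ = 0ℤ

shift-≤ : ∀ {a n} f → a ≤ n → shift a f n ≡ f (n ∸ a)
shift-≤ {a} {n} f a≤n with a ≤? n
... | yes _   = refl
... | no  a≰n = contradiction a≤n a≰n

shift-≰ : ∀ {a n} f → ¬ a ≤ n → shift a f n ≡ 0ℤ
shift-≰ {a} {n} f a≰n with a ≤? n
... | yes a≤n = contradiction a≤n a≰n
... | no  _   = refl

shift-at-0 : ∀ a f → shift a f 0 ≡ one a * f 0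
shift-at-0 zero    f = sym (ℤ.*-identityˡ (f 0))
shift-at-0 (suc a) f = sym (ℤ.*-zeroˡ (f 0))

⊛-congˡ : ∀ {f g} h → f ≗ g → (f ⊛ h) ≗ (g ⊛ h)
⊛-congˡ h f≗g n = sumUpTo-cong n (λ i _ → cong (_* h (n ∸ i)) (f≗g i))

⊛-congʳ : ∀ f {g h} → g ≗ h → (f ⊛ g) ≗ (f ⊛ h)
⊛-congʳ f g≗h n = sumUpTo-cong n (λ i _ → cong (f i *_) (g≗h (n ∸ i)))

⊛-monomial : ∀ f a → (f ⊛ monomial a) ≗ shift a f
⊛-monomial f a n with a ≤? n
... | yes a≤n =
  trans (sumUpTo-single n (n ∸ a) (ℕ.m∸n≤m n a) offDiagonal) diagonal
  where
  diagonal : f (n ∸ a) * monomial a (n ∸ (n ∸ a)) ≡ f (n ∸ a)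
  diagonal = trans (cong (λ k → f (n ∸ a) * monomial a k) (ℕ.m∸[m∸n]≡n a≤n))
             (trans (cong (f (n ∸ a) *_) (monomial-diag a)) (ℤ.*-identityʳ _))
  offDiagonal : ∀ i → i ≤ n → i ≢ n ∸ a → f i * monomial a (n ∸ i) ≡ 0ℤ
  offDiagonal i i≤n i≢n∸a =
    trans (cong (f i *_) (monomial-off λ n∸i≡a →
            i≢n∸a (trans (sym (ℕ.m∸[m∸n]≡n i≤n)) (cong (n ∸_) n∸i≡a))))
          (ℤ.*-zeroʳ (f i))
... | no a≰n =
  sumUpTo-zero n λ i i≤n →
    trans (cong (f i *_) (monomial-off λ n∸i≡a → a≰n (subst (_≤ n) n∸i≡a (ℕ.m∸n≤m n i))))
          (ℤ.*-zeroʳ (f i))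

shift-dilate : ∀ {f h : ℕ → ℤ} {m r} → r < m → (∀ k → f (k *ℕ m +ℕ r) ≡ h k) →
               ∀ j q → shift (j *ℕ m) f (q *ℕ m +ℕ r) ≡ shift j h q
shift-dilate {f} {h} {m} {r} r<m f≡h j q with j ≤? q
... | yes j≤q = trans (shift-≤ f jm≤qm+r) (trans (cong f index) (f≡h (q ∸ j)))
  where
  jm≤qm+r : j *ℕ m ≤ q *ℕ m +ℕ r
  jm≤qm+r = ℕ.≤-trans (ℕ.*-monoˡ-≤ m j≤q) (ℕ.m≤m+n (q *ℕ m) r)
  index : (q *ℕ m +ℕ r) ∸ j *ℕ m ≡ (q ∸ j) *ℕ m +ℕ r
  index = trans (ℕ.+-∸-comm r (ℕ.*-monoˡ-≤ m j≤q)) (cong (_+ℕ r) (sym (ℕ.*-distribʳ-∸ m q j)))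
... | no j≰q = shift-≰ f (ℕ.<⇒≱ qm+r<jm)
  where
  qm+r<jm : q *ℕ m +ℕ r < j *ℕ m
  qm+r<jm = ℕ.<-≤-trans (ℕ.+-monoʳ-< (q *ℕ m) r<m)
                        (subst (_≤ j *ℕ m) (ℕ.+-comm m (q *ℕ m)) (ℕ.*-monoˡ-≤ m (ℕ.≰⇒> j≰q)))

-- The list of terms (c , j) stands for the polynomial Σ c · y^j.
Poly : Set
Poly = List (ℤ × ℕ)

termSum : Poly → (ℕ → ℤ) → ℤ
termSum []            f = 0ℤ
termSum ((c , j) ∷ p) f = c * f j + termSum p f

evalPow : ℕ → Poly → PowerSeries
evalPow m p n = termSum p (λ j → monomial (j *ℕ m) n)

infix  8 X^_
infixl 7 _*P_
infixl 6 _+P_ _-P_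

X^_ : ℕ → Poly
X^ j = (1ℤ , j) ∷ []

_+P_ : Poly → Poly → Poly
_+P_ = _++_

scale : ℤ → Poly → Poly
scale c []             = []
scale c ((c′ , j) ∷ p) = (c * c′ , j) ∷ scale c p

_-P_ : Poly → Poly → Poly
p -P q = p +P scale -1ℤ q

shiftExp : ℕ → Poly → Poly
shiftExp j []             = []
shiftExp j ((c , j′) ∷ p) = (c , j′ +ℕ j) ∷ shiftExp j p

_*P_ : Poly → Poly → Poly
p *P []            = []
p *P ((c , j) ∷ q) = scale c (shiftExp j p) +P p *P q

termSum-cong : ∀ p {f g : ℕ → ℤ} → f ≗ g → termSum p f ≡ termSum p g
termSum-cong []            f≗g = refl
termSum-cong ((c , j) ∷ p) f≗g = cong₂ _+_ (cong (c *_) (f≗g j)) (termSum-cong p f≗g)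

termSum-vanish : ∀ {p} {f : ℕ → ℤ} → All (λ term → f (proj₂ term) ≡ 0ℤ) p → termSum p f ≡ 0ℤ
termSum-vanish []                           = refl
termSum-vanish {(c , j) ∷ p} (fj≡0 ∷ rest) =
  cong₂ _+_ (trans (cong (c *_) fj≡0) (ℤ.*-zeroʳ c)) (termSum-vanish rest)

termSum-zero : ∀ p {f : ℕ → ℤ} → (∀ j → f j ≡ 0ℤ) → termSum p f ≡ 0ℤ
termSum-zero p f≡0 = termSum-vanish (All.universal (f≡0 ∘ proj₂) p)

termSum-++ : ∀ p q f → termSum (p ++ q) f ≡ termSum p f + termSum q f
termSum-++ []            q f = sym (ℤ.+-identityˡ _)
termSum-++ ((c , j) ∷ p) q f =
  trans (cong (c * f j +_) (termSum-++ p q f)) (sym (ℤ.+-assoc (c * f j) _ _))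

termSum-scale : ∀ c p f → termSum (scale c p) f ≡ c * termSum p f
termSum-scale c []             f = sym (ℤ.*-zeroʳ c)
termSum-scale c ((c′ , j) ∷ p) f =
  trans (cong₂ _+_ (ℤ.*-assoc c c′ (f j)) (termSum-scale c p f))
        (sym (ℤ.*-distribˡ-+ c (c′ * f j) _))

termSum-shiftExp : ∀ j p f → termSum (shiftExp j p) f ≡ termSum p (λ j′ → f (j′ +ℕ j))
termSum-shiftExp j []             f = refl
termSum-shiftExp j ((c , j′) ∷ p) f = cong (c * f (j′ +ℕ j) +_) (termSum-shiftExp j p f)

termSum-*ʳ : ∀ p f a → termSum p (λ j → f j * a) ≡ termSum p f * a
termSum-*ʳ []            f a = sym (ℤ.*-zeroˡ a)
termSum-*ʳ ((c , j) ∷ p) f a =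
  trans (cong₂ _+_ (sym (ℤ.*-assoc c (f j) a)) (termSum-*ʳ p f a))
        (sym (ℤ.*-distribʳ-+ a (c * f j) _))

⊛-termSum : ∀ f p (h : ℕ → PowerSeries) →
            (f ⊛ (λ k → termSum p (λ j → h j k))) ≗ (λ n → termSum p (λ j → (f ⊛ h j) n))
⊛-termSum f []            h n = sumUpTo-zero n (λ i _ → ℤ.*-zeroʳ (f i))
⊛-termSum f ((c , j) ∷ p) h n =
  trans (sumUpTo-cong n (λ i _ → distrib (f i) c (h j (n ∸ i)) _))
        (trans (sumUpTo-linear n c _ _) (cong (c * (f ⊛ h j) n +_) (⊛-termSum f p h n)))
  where
  distrib : ∀ a c x y → a * (c * x + y) ≡ c * (a * x) + a * y
  distrib = solve-∀

⊛-evalPow : ∀ f m p → (f ⊛ evalPow m p) ≗ (λ n → termSum p (λ j → shift (j *ℕ m) f n))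
⊛-evalPow f m p n =
  trans (⊛-termSum f p (λ j → monomial (j *ℕ m)) n)
        (termSum-cong p (λ j → ⊛-monomial f (j *ℕ m) n))

shift-evalPow : ∀ m j p → shift (j *ℕ m) (evalPow m p) ≗ evalPow m (shiftExp j p)
shift-evalPow m j p n with j *ℕ m ≤? n
... | yes jm≤n =
  trans (termSum-cong p λ j′ → trans (monomial-∸ (j′ *ℕ m) jm≤n)
                                     (cong (λ e → monomial e n) (sym (ℕ.*-distribʳ-+ m j′ j))))
        (sym (termSum-shiftExp j p _))
... | no jm≰n =
  sym (trans (termSum-shiftExp j p _) (termSum-zero p λ j′ →
    monomial-off λ n≡[j′+j]m → jm≰n (subst (j *ℕ m ≤_)
      (trans (sym (ℕ.*-distribʳ-+ m j′ j)) (sym n≡[j′+j]m)) (ℕ.m≤n+m (j *ℕ m) (j′ *ℕ m)))))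

evalPow-*P : ∀ m p q → (evalPow m p ⊛ evalPow m q) ≗ evalPow m (p *P q)
evalPow-*P m p q n = trans (⊛-evalPow (evalPow m p) m q n) (expand q)
  where
  expand : ∀ q → termSum q (λ j → shift (j *ℕ m) (evalPow m p) n) ≡ evalPow m (p *P q) n
  expand []            = refl
  expand ((c , j) ∷ q) =
    trans (cong₂ _+_ (cong (c *_) (shift-evalPow m j p n)) (expand q))
          (sym (trans (termSum-++ (scale c (shiftExp j p)) (p *P q) _)
                      (cong (_+ evalPow m (p *P q) n) (termSum-scale c (shiftExp j p) _))))

≗evalPow-monomial : ∀ m j {k} → k ≡ j *ℕ m → monomial k ≗ evalPow m (X^ j)
≗evalPow-monomial m j refl n = sym (trans (ℤ.+-identityʳ _) (ℤ.*-identityˡ _))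

≗evalPow-one : ∀ m → one ≗ evalPow m (X^ 0)
≗evalPow-one m n = trans (one≗monomial-0 n) (≗evalPow-monomial m 0 refl n)

≗evalPow-⊕ : ∀ {f g} m p q → f ≗ evalPow m p → g ≗ evalPow m q → (f ⊕ g) ≗ evalPow m (p +P q)
≗evalPow-⊕ m p q f≗p g≗q n = trans (cong₂ _+_ (f≗p n) (g≗q n)) (sym (termSum-++ p q _))

≗evalPow-⊝ : ∀ {f g} m p q → f ≗ evalPow m p → g ≗ evalPow m q → (f ⊝ g) ≗ evalPow m (p -P q)
≗evalPow-⊝ m p q f≗p g≗q n =
  trans (cong₂ _+_ (f≗p n) (cong -_ (g≗q n)))
        (sym (trans (termSum-++ p (scale -1ℤ q) _)
                    (cong (evalPow m p n +_) (trans (termSum-scale -1ℤ q _) (ℤ.-1*i≡-i _)))))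

≗evalPow-⊛ : ∀ {f g} m p q → f ≗ evalPow m p → g ≗ evalPow m q → (f ⊛ g) ≗ evalPow m (p *P q)
≗evalPow-⊛ {f} m p q f≗p g≗q n =
  trans (⊛-congʳ f g≗q n) (trans (⊛-congˡ (evalPow m q) f≗p n) (evalPow-*P m p q n))

n<4^n : ∀ n → n < 4 ^ n
n<4^n zero    = s≤s z≤n
n<4^n (suc n) = ℕ.≤-trans (ℕ.+-mono-≤ {1} {4 ^ n} (ℕ.m^n>0 4 n) (n<4^n n))
                          (ℕ.+-monoʳ-≤ (4 ^ n) (ℕ.m≤m+n (4 ^ n) _))

[4q+b]/4≡q+b/4 : ∀ q b → (4 *ℕ q +ℕ b) / 4 ≡ q +ℕ b / 4
[4q+b]/4≡q+b/4 q b = begin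
  (4 *ℕ q +ℕ b) / 4   ≡⟨ cong (_/ 4) (trans (ℕ.+-comm (4 *ℕ q) b) (cong (b +ℕ_) (ℕ.*-comm 4 q))) ⟩
  (b +ℕ q *ℕ 4) / 4   ≡⟨ +-distrib-/-∣ʳ b (divides q refl) ⟩
  b / 4 +ℕ q *ℕ 4 / 4 ≡⟨ cong (b / 4 +ℕ_) (m*n/n≡m q 4) ⟩
  b / 4 +ℕ q          ≡⟨ ℕ.+-comm (b / 4) q ⟩
  q +ℕ b / 4          ∎
  where open ≡-Reasoning

[4q+b]%4≡b%4 : ∀ q b → (4 *ℕ q +ℕ b) % 4 ≡ b % 4
[4q+b]%4≡b%4 q b =
  trans (cong (_% 4) (trans (ℕ.+-comm (4 *ℕ q) b) (cong (b +ℕ_) (ℕ.*-comm 4 q))))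
        ([m+kn]%n≡m%n b q 4)

State : Set
State = ℤ × ℤ × ℤ × ℤ

_≟ₛ_ : DecidableEquality State
_≟ₛ_ = ≡-dec ℤ._≟_ (≡-dec ℤ._≟_ (≡-dec ℤ._≟_ ℤ._≟_))

open import Data.List.Membership.DecPropositional _≟ₛ_ using (_∈?_)

coeff : State → ℕ → ℤ
coeff (a , _ , _ , _) 0 = a
coeff (_ , b , _ , _) 1 = b
coeff (_ , _ , c , _) 2 = c
coeff (_ , _ , _ , d) 3 = d
coeff _ (suc (suc (suc (suc _)))) = 0ℤ

coeff-≥4 : ∀ V {k} → 4 ≤ k → coeff V k ≡ 0ℤ
coeff-≥4 V (s≤s (s≤s (s≤s (s≤s _)))) = refl

initial : State
initial = 1ℤ , 0ℤ , 0ℤ , 0ℤ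

one≗coeff-initial : one ≗ coeff initial
one≗coeff-initial 0                         = refl
one≗coeff-initial 1                         = refl
one≗coeff-initial 2                         = refl
one≗coeff-initial 3                         = refl
one≗coeff-initial (suc (suc (suc (suc _)))) = refl

module DigitAutomaton (P : Poly) where

  productCoeff : State → ℕ → ℤ
  productCoeff V q = termSum P (λ j → shift j (coeff V) q)

  step : ℕ → State → State
  step t V =
    productCoeff V t , productCoeff V (4 +ℕ t) , productCoeff V (8 +ℕ t) , productCoeff V (12 +ℕ t)

  run : ℕ → ℕ → State → State
  run zero    r w = w
  run (suc M) r w = run M (r / 4) (step (r % 4) w)

  sequence : State → PowerSeries
  sequence w n = proj₁ (run n n w)

  run-split : ∀ l M n b w → b < 4 ^ l → run (l +ℕ M) (4 ^ l *ℕ n +ℕ b) w ≡ run M n (run l b w)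
  run-split zero    M n zero    w _        =
    cong (λ x → run M x w) (trans (ℕ.+-identityʳ _) (ℕ.*-identityˡ n))
  run-split zero    M n (suc b) w (s≤s ())
  run-split (suc l) M n b       w b<4^1+l =
    trans (cong₂ (λ x d → run (l +ℕ M) x (step d w)) quotient remainder)
          (run-split l M n (b / 4) (step (b % 4) w)
                     (m<n*o⇒m/o<n (subst (b <_) (ℕ.*-comm 4 (4 ^ l)) b<4^1+l)))
    where
    regroup : 4 ^ suc l *ℕ n +ℕ b ≡ 4 *ℕ (4 ^ l *ℕ n) +ℕ b
    regroup = cong (_+ℕ b) (ℕ.*-assoc 4 (4 ^ l) n)
    quotient : (4 ^ suc l *ℕ n +ℕ b) / 4 ≡ 4 ^ l *ℕ n +ℕ b / 4
    quotient = trans (cong (_/ 4) regroup) ([4q+b]/4≡q+b/4 (4 ^ l *ℕ n) b)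
    remainder : (4 ^ suc l *ℕ n +ℕ b) % 4 ≡ b % 4
    remainder = trans (cong (_% 4) regroup) ([4q+b]%4≡b%4 (4 ^ l *ℕ n) b)

  run-top : ∀ M t r w → t < 4 → r < 4 ^ M → run (suc M) (4 ^ M *ℕ t +ℕ r) w ≡ step t (run M r w)
  run-top M t r w t<4 r<4^M =
    trans (cong (λ L → run L (4 ^ M *ℕ t +ℕ r) w) (ℕ.+-comm 1 M))
          (trans (run-split M 1 t r w r<4^M) (cong (λ d → step d (run M r w)) (m<n⇒m%n≡m t<4)))

  Closed : List State → Set
  Closed L = All (λ v → All (λ t → step t v ∈ L) (upTo 4)) L

  closed? : ∀ L → Dec (Closed L)
  closed? L = all? (λ v → all? (λ t → step t v ∈? L) (upTo 4)) L

  reachable : ℕ → List State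
  reachable zero    = initial ∷ []
  reachable (suc k) =
    deduplicate _≟ₛ_ (concatMap (λ v → v ∷ map (λ t → step t v) (upTo 4)) (reachable k))

  run-∈ : ∀ {L} → Closed L → ∀ l b {w} → w ∈ L → run l b w ∈ L
  run-∈ closed zero    b w∈L = w∈L
  run-∈ closed (suc l) b w∈L =
    run-∈ closed l (b / 4) (All.lookup (All.lookup closed w∈L) (∈-upTo⁺ (m%n<n b 4)))

  module _ (P-constant : termSum P one ≡ 1ℤ) where

    productCoeff-0 : ∀ V → productCoeff V 0 ≡ proj₁ V
    productCoeff-0 V@(a , _) = begin
      termSum P (λ j → shift j (coeff V) 0) ≡⟨ termSum-cong P (λ j → shift-at-0 j (coeff V)) ⟩
      termSum P (λ j → one j * a)           ≡⟨ termSum-*ʳ P one a ⟩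
      termSum P one * a                     ≡⟨ cong (_* a) P-constant ⟩
      1ℤ * a                                ≡⟨ ℤ.*-identityˡ a ⟩
      a                                     ∎
      where open ≡-Reasoning

    head-run-suc : ∀ M n w → n < 4 ^ M → proj₁ (run (suc M) n w) ≡ proj₁ (run M n w)
    head-run-suc M n w n<4^M =
      trans (cong (λ x → proj₁ (run (suc M) x w)) (cong (_+ℕ n) (sym (ℕ.*-zeroʳ (4 ^ M)))))
            (trans (cong proj₁ (run-top M 0 n w (s≤s z≤n) n<4^M)) (productCoeff-0 (run M n w)))

    head-run-stable : ∀ d M n w → n < 4 ^ M → proj₁ (run (d +ℕ M) n w) ≡ proj₁ (run M n w)
    head-run-stable zero    M n w _       = refl
    head-run-stable (suc d) M n w n<4^M =
      trans (head-run-suc (d +ℕ M) n w (ℕ.<-≤-trans n<4^M (ℕ.^-monoʳ-≤ 4 (ℕ.m≤n+m M d))))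
            (head-run-stable d M n w n<4^M)

    head-run≡sequence : ∀ M n w → n ≤ M → proj₁ (run M n w) ≡ sequence w n
    head-run≡sequence M n w n≤M =
      trans (cong (λ L → proj₁ (run L n w)) (sym (ℕ.m∸n+n≡m n≤M)))
            (head-run-stable (M ∸ n) n n w (n<4^n n))

    sequence-kernel :
      ∀ l b w → b < 4 ^ l → ∀ n → sequence (run l b w) n ≡ sequence w (4 ^ l *ℕ n +ℕ b)
    sequence-kernel l b w b<4^l n = begin
      sequence (run l b w) n      ≡⟨ head-run≡sequence x n (run l b w) n≤x ⟨
      proj₁ (run x n (run l b w)) ≡⟨ cong proj₁ (run-split l x n b w b<4^l) ⟨
      proj₁ (run (l +ℕ x) x w)    ≡⟨ head-run≡sequence (l +ℕ x) x w (ℕ.m≤n+m x l) ⟩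
      sequence w x                ∎
      where
      open ≡-Reasoning
      x = 4 ^ l *ℕ n +ℕ b
      n≤x : n ≤ x
      n≤x = ℕ.≤-trans (ℕ.m≤n*m n (4 ^ l) {{ℕ.m^n≢0 4 l}}) (ℕ.m≤m+n (4 ^ l *ℕ n) b)

    sequence-automatic : ∀ {w} L → w ∈ L → Closed L → IsAutomatic 4 (sequence w)
    sequence-automatic {w} L w∈L closed = map sequence L , λ l b b<4^l →
      Any.map (λ { refl → sequence-kernel l b w b<4^l }) (∈-map⁺ sequence (run-∈ closed l b w∈L))

  module _ (P-degree : All (λ term → proj₂ term ≤ 12) P) where

    productCoeff-≥16 : ∀ V q → productCoeff V (16 +ℕ q) ≡ 0ℤ
    productCoeff-≥16 V q = termSum-vanish (All.map (λ {term} → vanishes (proj₂ term)) P-degree)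
      where
      vanishes : ∀ j → j ≤ 12 → shift j (coeff V) (16 +ℕ q) ≡ 0ℤ
      vanishes j j≤12 = trans (shift-≤ (coeff V) (ℕ.m+n≤o⇒n≤o 4 4+j≤16+q))
                              (coeff-≥4 V (ℕ.m+n≤o⇒m≤o∸n 4 4+j≤16+q))
        where
        4+j≤16+q : 4 +ℕ j ≤ 16 +ℕ q
        4+j≤16+q = ℕ.≤-trans (ℕ.+-monoʳ-≤ 4 j≤12) (ℕ.m≤m+n 16 q)

    coeff-step : ∀ t V k → coeff (step t V) k ≡ productCoeff V (4 *ℕ k +ℕ t)
    coeff-step t V 0 = refl
    coeff-step t V 1 = refl
    coeff-step t V 2 = refl
    coeff-step t V 3 = refl
    coeff-step t V (suc (suc (suc (suc k)))) =
      sym (trans (cong (productCoeff V) (regroup k t)) (productCoeff-≥16 V (4 *ℕ k +ℕ t)))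
      where
      regroup : ∀ k t → 4 *ℕ (4 +ℕ k) +ℕ t ≡ 16 +ℕ (4 *ℕ k +ℕ t)
      regroup = ℕ-Solver.solve-∀

    module _ (fac : ℕ → PowerSeries) (fac≗ : ∀ s → fac s ≗ evalPow (4 ^ s) P) where

      partialProduct-step :
        ∀ M t r → t < 4 → r < 4 ^ M →
        (∀ k → prodBelow fac M (k *ℕ 4 ^ M +ℕ r) ≡ coeff (run M r initial) k) →
        ∀ k → prodBelow fac (suc M) (k *ℕ 4 ^ suc M +ℕ (4 ^ M *ℕ t +ℕ r))
              ≡ coeff (run (suc M) (4 ^ M *ℕ t +ℕ r) initial) k
      partialProduct-step M t r t<4 r<m Q≗V k = begin
        (Q ⊛ fac M) x
          ≡⟨ ⊛-congʳ Q (fac≗ M) x ⟩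
        (Q ⊛ evalPow m P) x
          ≡⟨ ⊛-evalPow Q m P x ⟩
        termSum P (λ j → shift (j *ℕ m) Q x)
          ≡⟨ cong (λ y → termSum P (λ j → shift (j *ℕ m) Q y)) (regroup k t m r) ⟩
        termSum P (λ j → shift (j *ℕ m) Q ((4 *ℕ k +ℕ t) *ℕ m +ℕ r))
          ≡⟨ termSum-cong P (λ j → shift-dilate r<m Q≗V j (4 *ℕ k +ℕ t)) ⟩
        productCoeff V (4 *ℕ k +ℕ t)
          ≡⟨ coeff-step t V k ⟨
        coeff (step t V) k
          ≡⟨ cong (λ W → coeff W k) (run-top M t r initial t<4 r<m) ⟨
        coeff (run (suc M) (m *ℕ t +ℕ r) initial) k
          ∎
        where
        open ≡-Reasoning
        m = 4 ^ M
        Q = prodBelow fac M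
        V = run M r initial
        x = k *ℕ 4 ^ suc M +ℕ (m *ℕ t +ℕ r)
        regroup : ∀ k t m r → k *ℕ (4 *ℕ m) +ℕ (m *ℕ t +ℕ r) ≡ (4 *ℕ k +ℕ t) *ℕ m +ℕ r
        regroup = ℕ-Solver.solve-∀

      partialProduct-coeff :
        ∀ M r → r < 4 ^ M → ∀ k → prodBelow fac M (k *ℕ 4 ^ M +ℕ r) ≡ coeff (run M r initial) k
      partialProduct-coeff zero    zero    _        k =
        trans (cong one (trans (ℕ.+-identityʳ _) (ℕ.*-identityʳ k))) (one≗coeff-initial k)
      partialProduct-coeff zero    (suc r) (s≤s ())
      partialProduct-coeff (suc M) r′      r′<4^1+M k =
        subst (λ y → prodBelow fac (suc M) (k *ℕ 4 ^ suc M +ℕ y) ≡ coeff (run (suc M) y initial) k)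
              (sym r′≡mt+r)
              (partialProduct-step M t r (m<n*o⇒m/o<n r′<4^1+M) r<m (partialProduct-coeff M r r<m) k)
        where
        m = 4 ^ M
        instance
          m≢0 : NonZero m
          m≢0 = ℕ.m^n≢0 4 M
        t = r′ / m
        r = r′ % m
        r<m : r < m
        r<m = m%n<n r′ m
        r′≡mt+r : r′ ≡ m *ℕ t +ℕ r
        r′≡mt+r = trans (m≡m%n+[m/n]*n r′ m)
                        (trans (ℕ.+-comm r (t *ℕ m)) (cong (_+ℕ r) (ℕ.*-comm t m)))

  infiniteProduct-automatic :
    termSum P one ≡ 1ℤ → All (λ term → proj₂ term ≤ 12) P →
    ∀ fac → (∀ s → fac s ≗ evalPow (4 ^ s) P) →
    ∀ L → initial ∈ L → Closed L →
    Σ PowerSeries (λ F → IsInfiniteProduct fac F × IsAutomatic 4 F)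
  infiniteProduct-automatic P-constant P-degree fac fac≗ L initial∈L closed =
    sequence initial , isInfiniteProduct , sequence-automatic P-constant L initial∈L closed
    where
    isInfiniteProduct : IsInfiniteProduct fac (sequence initial)
    isInfiniteProduct n = n , λ M n≤M →
      trans (partialProduct-coeff P-degree fac fac≗ M n (ℕ.<-≤-trans (n<4^n n) (ℕ.^-monoʳ-≤ 4 n≤M)) 0)
            (head-run≡sequence P-constant M n initial n≤M)

trinomial : Poly
trinomial = X^ 2 +P X^ 1 +P X^ 0

P₂ : Poly
P₂ = trinomial *P ((X^ 6 -P X^ 0) *P (X^ 4 -P X^ 0))

P₃ : Poly
P₃ = trinomial *P ((X^ 6 +P X^ 0) *P (X^ 0 -P X^ 4))

trinomial≗evalPow : ∀ m → ((monomial (2 *ℕ m) ⊕ monomial m) ⊕ one) ≗ evalPow m trinomial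
trinomial≗evalPow m =
  ≗evalPow-⊕ m (X^ 2 +P X^ 1) (X^ 0)
    (≗evalPow-⊕ m (X^ 2) (X^ 1)
      (≗evalPow-monomial m 2 refl) (≗evalPow-monomial m 1 (sym (ℕ.*-identityˡ m))))
    (≗evalPow-one m)

factor₂≗evalPow : ∀ s → factor₂ s ≗ evalPow (4 ^ s) P₂
factor₂≗evalPow s =
  ≗evalPow-⊛ m trinomial ((X^ 6 -P X^ 0) *P (X^ 4 -P X^ 0)) (trinomial≗evalPow m)
    (≗evalPow-⊛ m (X^ 6 -P X^ 0) (X^ 4 -P X^ 0)
      (≗evalPow-⊝ m (X^ 6) (X^ 0) (≗evalPow-monomial m 6 refl) (≗evalPow-one m))
      (≗evalPow-⊝ m (X^ 4) (X^ 0) (≗evalPow-monomial m 4 refl) (≗evalPow-one m)))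
  where m = 4 ^ s

factor₃≗evalPow : ∀ s → factor₃ s ≗ evalPow (4 ^ s) P₃
factor₃≗evalPow s =
  ≗evalPow-⊛ m trinomial ((X^ 6 +P X^ 0) *P (X^ 0 -P X^ 4)) (trinomial≗evalPow m)
    (≗evalPow-⊛ m (X^ 6 +P X^ 0) (X^ 0 -P X^ 4)
      (≗evalPow-⊕ m (X^ 6) (X^ 0) (≗evalPow-monomial m 6 refl) (≗evalPow-one m))
      (≗evalPow-⊝ m (X^ 0) (X^ 4) (≗evalPow-one m) (≗evalPow-monomial m 4 refl)))
  where m = 4 ^ s

open DigitAutomaton using (infiniteProduct-automatic; reachable; closed?)

proposition6p1 : Σ PowerSeries (λ F₂ → IsInfiniteProduct factor₂ F₂ × IsAutomatic 4 F₂)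
    × Σ PowerSeries (λ F₃ → IsInfiniteProduct factor₃ F₃ × IsAutomatic 4 F₃)
proposition6p1 =
    infiniteProduct-automatic P₂ refl (from-yes (degree≤12? P₂)) factor₂ factor₂≗evalPow
                              L₂ (here refl) (from-yes (closed? P₂ L₂))
  , infiniteProduct-automatic P₃ refl (from-yes (degree≤12? P₃)) factor₃ factor₃≗evalPow
                              L₃ (here refl) (from-yes (closed? P₃ L₃))
  where
  degree≤12? : ∀ P → Dec (All (λ term → proj₂ term ≤ 12) P)
  degree≤12? = all? ((_≤? 12) ∘ proj₂)
  L₂ = reachable P₂ 3
  L₃ = reachable P₃ 3
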